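{- (Provable in $\mathsf{RCA}_0$.) Let $X\subseteq\operatorname{FIN}_{A\star}$ be an infinite block sequence and $f:[X]_A\to C$ a coloring such that $X$ is weakly $f$-thin for some color $i\in C$. Then there is an infinite block sequence $Y\subseteq[X]_{A\star}$ which is $f$-thin for color $i$.
   Context: $A$ finite nonempty alphabet, $C$ finite nonempty color set, $\star\notin A$. A located word is a function from a finite nonempty subset of $\mathbb{N}$ into $A$ ($\operatorname{FIN}_A$); a located variable word is a function from a finite nonempty subset of $\mathbb{N}$ into $A\cup\{\star\}$ taking value $\star$ at least once ($\operatorname{FIN}_{A\star}$). For $a\in A$, $p[a]$ replaces each $\star$ by $a$; $p[\star]=p$. $p<q$ means $\max\operatorname{dom}p<\min\operatorname{dom}q$. A block sequence is a subset of $\operatorname{FIN}_{A\star}$ totally ordered by $<$. For a block sequence $X$, $[X]_A$ is the set of all $p_0[a_0]\cup\dots\cup p_k[a_k]$ with $p_0<\dots<p_k$ in $X$, $a_j\in A$; $[X]_{A\star}$ the set of such unions with $a_j\in A\cup\{\star\}$ and at least one $a_j=\star$. Given a coloring $f:[X]_A\to C$, a block sequence $Y\subseteq[X]_{A\star}$ is weakly $f$-thin for color $i$ if for every $p\in[Y]_{A\star}$ there is $a\in A$ with $f(p[a])\neq i$; it is $f$-thin for color $i$ if $f(p)\ne i$ for every $p\in[Y]_A$. -}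

module Defs where

open import Data.Nat using (ℕ; _<_)
open import Data.Fin using (Fin)
open import Data.Maybe using (Maybe; just; nothing; fromMaybe)
open import Data.Product using (Σ; ∃; _×_; _,_; proj₁; proj₂)
open import Data.List using (List; []; _∷_; map; concatMap; length)
open import Data.List.Relation.Unary.All using (All)
open import Data.List.Relation.Unary.Any using (Any)
open import Data.List.Relation.Unary.Linked using (Linked)
open import Relation.Binary.PropositionalEquality using (_≡_; _≢_)

-- Alphabet A = Fin (suc n) (finite nonempty), letters of A ∪ {⋆} = Maybe A,
-- with nothing playing the role of ⋆.

-- Valid located words have strictly increasing positions and are nonempty,
-- so they represent functions from finite nonempty subsets of ℕ.
Word : ℕ → Set
Word n = List (ℕ × Fin n)

VWord : ℕ → Set
VWord n = List (ℕ × Maybe (Fin n))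

Incr : {B : Set} → List (ℕ × B) → Set
Incr = Linked (λ x y → proj₁ x < proj₁ y)

NonEmpty : {B : Set} → List B → Set
NonEmpty xs = 0 < length xs

IsVarWord : {n : ℕ} → VWord n → Set
IsVarWord p = NonEmpty p × Incr p × Any (λ x → proj₂ x ≡ nothing) p

_≺_ : {B B' : Set} → List (ℕ × B) → List (ℕ × B') → Set
p ≺ q = All (λ x → All (λ y → proj₁ x < proj₁ y) q) p

_[_] : {n : ℕ} → VWord n → Fin n → Word n
p [ a ] = map (λ x → proj₁ x , fromMaybe a (proj₂ x)) p

_[_]⋆ : {n : ℕ} → VWord n → Maybe (Fin n) → VWord n
p [ nothing ]⋆ = p
p [ just a ]⋆ = map (λ x → proj₁ x , just (fromMaybe a (proj₂ x))) p

BlockSeq : ℕ → Set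
BlockSeq n = Σ (ℕ → VWord n) λ X → (∀ k → IsVarWord (X k)) × (∀ k → X k ≺ X (Data.Nat.suc k))
  where import Data.Nat

-- A choice of elements X k₀ < ... < X k_r (k₀ < ... < k_r) with letters.
-- Valid choices: nonempty, strictly increasing indices.
ValidChoice : {B : Set} → List (ℕ × B) → Set
ValidChoice s = NonEmpty s × Incr s

combA : {n : ℕ} → BlockSeq n → List (ℕ × Fin n) → Word n
combA (X , _) s = concatMap (λ x → X (proj₁ x) [ proj₂ x ]) s

combA⋆ : {n : ℕ} → BlockSeq n → List (ℕ × Maybe (Fin n)) → VWord n
combA⋆ (X , _) s = concatMap (λ x → X (proj₁ x) [ proj₂ x ]⋆) s

ValidChoice⋆ : {n : ℕ} → List (ℕ × Maybe (Fin n)) → Set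
ValidChoice⋆ s = ValidChoice s × Any (λ x → proj₂ x ≡ nothing) s

_∈[_]A⋆ : {n : ℕ} → VWord n → BlockSeq n → Set
p ∈[ X ]A⋆ = ∃ λ s → ValidChoice⋆ s × p ≡ combA⋆ X s

_⊆[_]A⋆ : {n : ℕ} → BlockSeq n → BlockSeq n → Set
Y ⊆[ X ]A⋆ = ∀ k → proj₁ Y k ∈[ X ]A⋆

WeaklyThin : {n : ℕ} {C : Set} → BlockSeq n → (Word n → C) → C → Set
WeaklyThin {n} X f i =
  (s : List (ℕ × Maybe (Fin n))) → ValidChoice⋆ s → ∃ λ (a : Fin n) → f (combA⋆ X s [ a ]) ≢ i

Thin : {n : ℕ} {C : Set} → BlockSeq n → (Word n → C) → C → Set
Thin {n} Y f i = (s : List (ℕ × Fin n)) → ValidChoice s → f (combA Y s) ≢ i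

-- Y is built one block at a time. Before stage j the blocks Y₀, …, Y_{j-1} lie below some
-- index t of X, and the words they generate in [X]_A, together with the empty word, form a
-- finite list W. Colour u ∈ A^N by the first w ∈ W such that w followed by u, placed on
-- X_t, …, X_{t+N-1}, has colour i. The Hales–Jewett theorem gives a line on which this first
-- witness is the same at every point; if there were one, w followed by the line would be a word
-- of [X]_{A⋆} all of whose instances have colour i, contradicting weak thinness. So the line,
-- placed at t, is taken as Y_j, and no word of [Y]_A has colour i, since it is a word of W followed
-- by an instance of its last block.
--
-- The Hales–Jewett theorem itself is proved by the focusing argument: split the coordinates into
-- a head and a tail, colour each tail by the whole colouring it induces on the head, and use the
-- theorem for one letter fewer on the tail to add one more line to a family of lines through a
-- common focus, monochromatic off the focus in pairwise distinct colours. There are never r + 1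
-- such lines, so after r + 1 steps a monochromatic line has turned up.

module Submission where

open import Defs
open import Data.Nat using (ℕ; zero; suc; _+_; _^_; _≤_; _<_; z≤n; s≤s; z<s)
import Data.Nat.Properties as ℕP
open import Data.Fin using (Fin; zero; suc; funToFin; finToFun)
open import Data.Fin.Properties as FinP using (finToFun-funToFin; pigeonhole; <-irrefl)
open import Data.Maybe as Maybe using (Maybe; just; nothing; fromMaybe)
open import Data.Vec as Vec using (Vec; []; _∷_; tabulate; lookup)
import Data.Vec.Properties as VecP
open import Data.Vec.Relation.Unary.Any as VecAny using (here; there)
import Data.Vec.Relation.Unary.Any.Properties as VecAnyP
open import Data.List as List
  using (List; []; _∷_; _∷ʳ_; length; concat; concatMap; allFin; cartesianProductWith; initLast; _∷ʳ′_)
import Data.List.Properties as ListP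
open import Data.List.Relation.Unary.All as All using (All; []; _∷_)
import Data.List.Relation.Unary.All.Properties as AllP
open import Data.List.Relation.Unary.Any as Any using (Any; here; there)
import Data.List.Relation.Unary.Any.Properties as AnyP
open import Data.List.Relation.Unary.AllPairs as AllPairs using (AllPairs; []; _∷_)
import Data.List.Relation.Unary.AllPairs.Properties as AllPairsP
open import Data.List.Relation.Unary.Linked.Properties using (Linked⇒AllPairs; AllPairs⇒Linked)
open import Data.List.Membership.Propositional using (_∈_; lose)
open import Data.List.Membership.Propositional.Properties
  using ( ∈-lookup; ∈-++⁺ˡ; ∈-++⁺ʳ; ∈-++⁻; ∈-allFin
        ; ∈-cartesianProductWith⁺; ∈-cartesianProductWith⁻)
open import Data.Product using (Σ; ∃-syntax; _×_; _,_; proj₁; proj₂)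
open import Data.Sum using (_⊎_; inj₁; inj₂)
open import Data.Empty using (⊥-elim)
open import Function using (_∘_)
open import Relation.Nullary using (Dec; yes; no; ¬_)
open import Relation.Binary.Definitions using (DecidableEquality)
open import Relation.Binary.PropositionalEquality hiding ([_])
open ≡-Reasoning

private
  variable
    k r N M t t′ : ℕ
    B B′ B″ : Set

module HalesJewett where

  open import Data.Vec using (_++_)

  Line : ℕ → ℕ → Set
  Line k N = Vec (Maybe (Fin k)) N

  _⟨_⟩ : Line k N → Fin k → Vec (Fin k) N
  l ⟨ a ⟩ = Vec.map (fromMaybe a) l

  IsLine : Line k N → Set
  IsLine = VecAny.Any (_≡ nothing)

  MonochromaticLine : (Vec (Fin k) N → Fin r) → Set
  MonochromaticLine {k} {N} C = Σ (Line k N) λ l → IsLine l × (∀ a b → C (l ⟨ a ⟩) ≡ C (l ⟨ b ⟩))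

  HalesJewett : ℕ → Set
  HalesJewett k = ∀ r → ∃[ N ] ∀ (C : Vec (Fin k) N → Fin r) → MonochromaticLine C

  ⟨⟩-++ : (u : Line k N) (v : Line k M) (a : Fin k) → (u ++ v) ⟨ a ⟩ ≡ u ⟨ a ⟩ ++ v ⟨ a ⟩
  ⟨⟩-++ u v a = VecP.map-++ (fromMaybe a) u v

  ⟨⟩-const : (x : Vec (Fin k) N) (a : Fin k) → Vec.map just x ⟨ a ⟩ ≡ x
  ⟨⟩-const []      a = refl
  ⟨⟩-const (x ∷ xs) a = cong (x ∷_) (⟨⟩-const xs a)

  shift : Line k N → Line (suc k) N
  shift = Vec.map (Maybe.map suc)

  ⟨⟩-shift : (l : Line k N) (a : Fin k) → shift l ⟨ suc a ⟩ ≡ Vec.map suc (l ⟨ a ⟩)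
  ⟨⟩-shift []             a = refl
  ⟨⟩-shift (just x ∷ l)  a = cong (suc x ∷_) (⟨⟩-shift l a)
  ⟨⟩-shift (nothing ∷ l) a = cong (suc a ∷_) (⟨⟩-shift l a)

  isLine-shift : {l : Line k N} → IsLine l → IsLine (shift l)
  isLine-shift = VecAnyP.map⁺ ∘ VecAny.map (cong (Maybe.map suc))

  encode : (Vec (Fin k) N → Fin r) → Fin (r ^ (k ^ N))
  encode C = funToFin (C ∘ tabulate ∘ finToFun)

  encode-injective : (C D : Vec (Fin k) N → Fin r) → encode C ≡ encode D → ∀ x → C x ≡ D x
  encode-injective {k = k} {N = N} C D eq x = begin
    C x                         ≡⟨ cong C decode-x ⟨
    C (tabulate (finToFun c))   ≡⟨ finToFun-funToFin _ c ⟨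
    finToFun (encode C) c       ≡⟨ cong (λ e → finToFun e c) eq ⟩
    finToFun (encode D) c       ≡⟨ finToFun-funToFin _ c ⟩
    D (tabulate (finToFun c))   ≡⟨ cong D decode-x ⟩
    D x                         ∎
    where
    c : Fin (k ^ N)
    c = funToFin (lookup x)
    decode-x : tabulate (finToFun c) ≡ x
    decode-x = trans (VecP.tabulate-cong (finToFun-funToFin (lookup x))) (VecP.tabulate∘lookup x)

  record FocusedLines (C : Vec (Fin (suc k)) N → Fin r) (s : ℕ) : Set where
    field
      focus            : Vec (Fin (suc k)) N
      line             : Fin s → Line (suc k) N
      colour           : Fin s → Fin r
      colour-injective : ∀ j j′ → colour j ≡ colour j′ → j ≡ j′
      isLine           : ∀ j → IsLine (line j)
      line-focus       : ∀ j → line j ⟨ zero ⟩ ≡ focus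
      line-colour      : ∀ j a → C (line j ⟨ suc a ⟩) ≡ colour j

  module _ {C : Vec (Fin (suc k)) N → Fin r} where

    ¬focusedLines : ¬ FocusedLines C (suc r)
    ¬focusedLines F with pigeonhole (ℕP.n<1+n _) (FocusedLines.colour F)
    ... | j , j′ , j<j′ , eq = <-irrefl (FocusedLines.colour-injective F j j′ eq) j<j′

    focusedLines⇒monochromatic : ∀ {s} (F : FocusedLines C s) j →
      C (FocusedLines.focus F) ≡ FocusedLines.colour F j → MonochromaticLine C
    focusedLines⇒monochromatic F j eq = line j , isLine j , λ a b → trans (colour-at a) (sym (colour-at b))
      where
      open FocusedLines F
      colour-at : ∀ a → C (line j ⟨ a ⟩) ≡ colour j
      colour-at zero    = trans (cong C (line-focus j)) eq
      colour-at (suc a) = line-colour j a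

  -- C-l makes C (x ++ y) independent of which instance of l the tail y is, so C behaves like the
  -- colouring D of the head; the unused letter 0 of the shifted line provides the new focus.
  module Reduction {N₀ N₁ : ℕ} (C : Vec (Fin (suc (suc k))) (N₀ + N₁) → Fin r)
                   (l : Line (suc k) N₁) (isLine-l : IsLine l)
                   (C-l : ∀ a x → C (x ++ Vec.map suc (l ⟨ a ⟩)) ≡ C (x ++ Vec.map suc (l ⟨ zero ⟩))) where

    tail : Vec (Fin (suc (suc k))) N₁
    tail = Vec.map suc (l ⟨ zero ⟩)

    D : Vec (Fin (suc (suc k))) N₀ → Fin r
    D x = C (x ++ tail)

    C-const : ∀ (m : Line (suc (suc k)) N₀) b → C ((m ++ Vec.map just tail) ⟨ b ⟩) ≡ D (m ⟨ b ⟩)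
    C-const m b = cong C (trans (⟨⟩-++ m (Vec.map just tail) b) (cong (m ⟨ b ⟩ ++_) (⟨⟩-const tail b)))

    C-shift : ∀ (m : Line (suc (suc k)) N₀) a → C ((m ++ shift l) ⟨ suc a ⟩) ≡ D (m ⟨ suc a ⟩)
    C-shift m a = begin
      C ((m ++ shift l) ⟨ suc a ⟩)               ≡⟨ cong C (⟨⟩-++ m (shift l) (suc a)) ⟩
      C (m ⟨ suc a ⟩ ++ shift l ⟨ suc a ⟩)       ≡⟨ cong (λ y → C (m ⟨ suc a ⟩ ++ y)) (⟨⟩-shift l a) ⟩
      C (m ⟨ suc a ⟩ ++ Vec.map suc (l ⟨ a ⟩))   ≡⟨ C-l a (m ⟨ suc a ⟩) ⟩
      D (m ⟨ suc a ⟩)                            ∎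

    monochromatic-lift : MonochromaticLine D → MonochromaticLine C
    monochromatic-lift (m , isLine-m , D-m) = m ++ Vec.map just tail , VecAnyP.++⁺ˡ isLine-m ,
      λ a b → trans (C-const m a) (trans (D-m a b) (sym (C-const m b)))

    focused-extend : ∀ {s} (F : FocusedLines D s) → (∀ j → D (FocusedLines.focus F) ≢ FocusedLines.colour F j) →
                     FocusedLines C (suc s)
    focused-extend {s} F new = record
      { focus = focus ++ shift l ⟨ zero ⟩ ; line = line′ ; colour = colour′ ; colour-injective = colour′-injective
      ; isLine = isLine′ ; line-focus = line′-focus ; line-colour = line′-colour }
      where
      open FocusedLines F
      line′ : Fin (suc s) → Line (suc (suc k)) (N₀ + N₁)
      line′ zero    = Vec.map just focus ++ shift l
      line′ (suc j) = line j ++ shift l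
      colour′ : Fin (suc s) → Fin r
      colour′ zero    = D focus
      colour′ (suc j) = colour j
      colour′-injective : ∀ j j′ → colour′ j ≡ colour′ j′ → j ≡ j′
      colour′-injective zero    zero     eq = refl
      colour′-injective zero    (suc j′) eq = ⊥-elim (new j′ eq)
      colour′-injective (suc j) zero     eq = ⊥-elim (new j (sym eq))
      colour′-injective (suc j) (suc j′) eq = cong suc (colour-injective j j′ eq)
      isLine′ : ∀ j → IsLine (line′ j)
      isLine′ zero    = VecAnyP.++⁺ʳ (Vec.map just focus) (isLine-shift isLine-l)
      isLine′ (suc j) = VecAnyP.++⁺ˡ (isLine j)
      line′-focus : ∀ j → line′ j ⟨ zero ⟩ ≡ focus ++ shift l ⟨ zero ⟩
      line′-focus zero    = trans (⟨⟩-++ (Vec.map just focus) (shift l) zero) (cong (_++ _) (⟨⟩-const focus zero))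
      line′-focus (suc j) = trans (⟨⟩-++ (line j) (shift l) zero) (cong (_++ _) (line-focus j))
      line′-colour : ∀ j a → C (line′ j ⟨ suc a ⟩) ≡ colour′ j
      line′-colour zero    a = trans (C-shift (Vec.map just focus) a) (cong D (⟨⟩-const focus (suc a)))
      line′-colour (suc j) a = trans (C-shift (line j) a) (line-colour j a)

    extend : ∀ {s} → MonochromaticLine D ⊎ FocusedLines D s → MonochromaticLine C ⊎ FocusedLines C (suc s)
    extend (inj₁ mono) = inj₁ (monochromatic-lift mono)
    extend (inj₂ F) with FinP.any? (λ j → D (FocusedLines.focus F) FinP.≟ FocusedLines.colour F j)
    ... | yes (j , eq) = inj₁ (monochromatic-lift (focusedLines⇒monochromatic F j eq))
    ... | no  ¬eq      = inj₂ (focused-extend F (λ j eq → ¬eq (j , eq)))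

  monochromatic-or-focused : HalesJewett (suc k) → ∀ r s →
    ∃[ N ] ∀ (C : Vec (Fin (suc (suc k))) N → Fin r) → MonochromaticLine C ⊎ FocusedLines C s
  monochromatic-or-focused hj r zero = 0 , λ C → inj₂ (record
    { focus = [] ; line = λ () ; colour = λ () ; colour-injective = λ ()
    ; isLine = λ () ; line-focus = λ () ; line-colour = λ () })
  monochromatic-or-focused {k} hj r (suc s) = N₀ + N₁ , step
    where
    N₀ N₁ : ℕ
    N₀ = proj₁ (monochromatic-or-focused hj r s)
    N₁ = proj₁ (hj (r ^ (suc (suc k) ^ N₀)))
    step : ∀ (C : Vec (Fin (suc (suc k))) (N₀ + N₁) → Fin r) → MonochromaticLine C ⊎ FocusedLines C (suc s)
    step C = extend (proj₂ (monochromatic-or-focused hj r s) D)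
      where
      headColouring : Vec (Fin (suc k)) N₁ → Vec (Fin (suc (suc k))) N₀ → Fin r
      headColouring w x = C (x ++ Vec.map suc w)
      tailLine : MonochromaticLine (encode ∘ headColouring)
      tailLine = proj₂ (hj (r ^ (suc (suc k) ^ N₀))) (encode ∘ headColouring)
      open Reduction C (proj₁ tailLine) (proj₁ (proj₂ tailLine))
        (λ a → encode-injective (headColouring _) (headColouring _) (proj₂ (proj₂ tailLine) a zero))

  hales-jewett-step : HalesJewett (suc k) → HalesJewett (suc (suc k))
  hales-jewett-step {k} hj r = N₀ , λ C → fromFocused (step C)
    where
    N₀ : ℕ
    N₀ = proj₁ (monochromatic-or-focused hj r (suc r))
    step : ∀ (C : Vec (Fin (suc (suc k))) N₀ → Fin r) → MonochromaticLine C ⊎ FocusedLines C (suc r)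
    step = proj₂ (monochromatic-or-focused hj r (suc r))
    fromFocused : ∀ {C : Vec (Fin (suc (suc k))) N₀ → Fin r} →
                  MonochromaticLine C ⊎ FocusedLines C (suc r) → MonochromaticLine C
    fromFocused (inj₁ mono) = mono
    fromFocused (inj₂ F)    = ⊥-elim (¬focusedLines F)

  hales-jewett : ∀ k → HalesJewett k
  hales-jewett zero          r = 1 , λ C → (nothing ∷ []) , here refl , λ ()
  hales-jewett (suc zero)    r = 1 , λ C → (nothing ∷ []) , here refl , λ { zero zero → refl }
  hales-jewett (suc (suc k))   = hales-jewett-step (hales-jewett (suc k))

  lineNumber : ℕ → ℕ → ℕ
  lineNumber k r = proj₁ (hales-jewett k r)

  module _ {B : Set} {Q : B → Set} {W : List B} where

    firstIndex : Dec (Any Q W) → Fin (suc (length W))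
    firstIndex (yes q) = suc (Any.index q)
    firstIndex (no _)  = zero

    firstIndex-suc : ∀ (d : Dec (Any Q W)) {j} → firstIndex d ≡ suc j → Q (List.lookup W j)
    firstIndex-suc (yes q) refl = AnyP.lookup-index q
    firstIndex-suc (no _)  ()

    firstIndex-any : ∀ (d : Dec (Any Q W)) → Any Q W → ∃[ j ] firstIndex d ≡ suc j
    firstIndex-any (yes q) _ = Any.index q , refl
    firstIndex-any (no ¬q) q = ⊥-elim (¬q q)

  record UniformWitnessLine {B : Set} (W : List B) (P : B → Vec (Fin k) N → Set) : Set where
    field
      line    : Line k N
      isLine  : IsLine line
      uniform : ∀ {w} a → w ∈ W → P w (line ⟨ a ⟩) → ∃[ w′ ] w′ ∈ W × ∀ b → P w′ (line ⟨ b ⟩)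

  uniformWitnessLine : ∀ {B : Set} (W : List B) (P : B → Vec (Fin k) (lineNumber k (suc (length W))) → Set) →
    (∀ w u → Dec (P w u)) → UniformWitnessLine W P
  uniformWitnessLine {k} W P P? = record { line = l ; isLine = proj₁ (proj₂ mono) ; uniform = uniform }
    where
    colour : Vec (Fin k) (lineNumber k (suc (length W))) → Fin (suc (length W))
    colour u = firstIndex (Any.any? (λ w → P? w u) W)
    mono : MonochromaticLine colour
    mono = proj₂ (hales-jewett k (suc (length W))) colour
    l : Line k (lineNumber k (suc (length W)))
    l = proj₁ mono
    uniform : ∀ {w} a → w ∈ W → P w (l ⟨ a ⟩) → ∃[ w′ ] w′ ∈ W × ∀ b → P w′ (l ⟨ b ⟩)
    uniform a w∈W p with firstIndex-any (Any.any? (λ w → P? w (l ⟨ a ⟩)) W) (lose w∈W p)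
    ... | j , eq = List.lookup W j , ∈-lookup j ,
                   λ b → firstIndex-suc (Any.any? (λ w → P? w (l ⟨ b ⟩)) W) (trans (proj₂ (proj₂ mono) b a) eq)

open HalesJewett

open import Data.List using (_++_)

_<ₚ_ : ℕ × B → ℕ × B′ → Set
x <ₚ y = proj₁ x < proj₁ y

Ascending : List (ℕ × B) → Set
Ascending = AllPairs _<ₚ_

Below Above : ℕ → List (ℕ × B) → Set
Below t = All (λ x → proj₁ x < t)
Above t = All (λ x → t ≤ proj₁ x)

incr⇒ascending : {xs : List (ℕ × B)} → Incr xs → Ascending xs
incr⇒ascending = Linked⇒AllPairs ℕP.<-trans

below-above⇒≺ : {xs : List (ℕ × B)} {ys : List (ℕ × B′)} → Below t xs → Above t ys → xs ≺ ys
below-above⇒≺ xs<t t≤ys = All.map (λ x<t → All.map (ℕP.<-≤-trans x<t) t≤ys) xs<t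

ascending-++ : {xs ys : List (ℕ × B)} → Ascending xs → Below t xs → Ascending ys → Above t ys →
               Ascending (xs ++ ys)
ascending-++ asc-xs xs<t asc-ys t≤ys = AllPairsP.++⁺ asc-xs asc-ys (below-above⇒≺ xs<t t≤ys)

below-mono : {xs : List (ℕ × B)} → t ≤ t′ → Below t xs → Below t′ xs
below-mono t≤t′ = All.map (λ x<t → ℕP.<-≤-trans x<t t≤t′)

≺-trans : {p : List (ℕ × B)} {q : List (ℕ × B′)} {r : List (ℕ × B″)} →
          NonEmpty q → p ≺ q → q ≺ r → p ≺ r
≺-trans {q = z ∷ _} _ p≺q (z≺r ∷ _) = All.map (λ x≺q → All.map (ℕP.<-trans (All.head x≺q)) z≺r) p≺q

≺-concatʳ : {p : List (ℕ × B)} {qs : List (List (ℕ × B′))} → All (p ≺_) qs → p ≺ concat qs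
≺-concatʳ = All.map AllP.concat⁺ ∘ AllP.All-swap

ascending-∷ʳ⁻ : ∀ {xs : List (ℕ × B)} {x} → Ascending (xs ∷ʳ x) → Ascending xs × All (_<ₚ x) xs
ascending-∷ʳ⁻ {xs = []}     _            = [] , []
ascending-∷ʳ⁻ {xs = y ∷ xs} (y< ∷ asc) =
  AllP.++⁻ˡ xs y< ∷ proj₁ (ascending-∷ʳ⁻ asc) ,
  All.head (AllP.++⁻ʳ xs y<) ∷ proj₂ (ascending-∷ʳ⁻ asc)

any⇒nonEmpty : ∀ {P : B → Set} {xs} → Any P xs → NonEmpty xs
any⇒nonEmpty (here _)  = s≤s z≤n
any⇒nonEmpty (there _) = s≤s z≤n

[]⋆-ascending : (c : Maybe (Fin k)) {p : VWord k} → Ascending p → Ascending (p [ c ]⋆)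
[]⋆-ascending nothing  asc = asc
[]⋆-ascending (just a) asc = AllPairsP.map⁺ asc

[]⋆-≺ : (c c′ : Maybe (Fin k)) {p q : VWord k} → p ≺ q → (p [ c ]⋆) ≺ (q [ c′ ]⋆)
[]⋆-≺ nothing  nothing   p≺q = p≺q
[]⋆-≺ nothing  (just b)  p≺q = All.map AllP.map⁺ p≺q
[]⋆-≺ (just a) nothing   p≺q = AllP.map⁺ p≺q
[]⋆-≺ (just a) (just b)  p≺q = AllP.map⁺ (All.map AllP.map⁺ p≺q)

[]⋆-[] : (p : VWord k) (c : Maybe (Fin k)) (a : Fin k) → (p [ c ]⋆) [ a ] ≡ p [ fromMaybe a c ]
[]⋆-[] p nothing  a = refl
[]⋆-[] p (just b) a = sym (ListP.map-∘ p)

place : ℕ → Vec B N → List (ℕ × B)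
place t []      = []
place t (b ∷ v) = (t , b) ∷ place (suc t) v

place-above : (v : Vec B N) → Above t (place t v)
place-above []      = []
place-above (b ∷ v) = ℕP.≤-refl ∷ All.map ℕP.<⇒≤ (place-above v)

place-below : (v : Vec B N) → Below (t + N) (place t v)
place-below                 []      = []
place-below {N = suc N} {t} (b ∷ v) =
  ℕP.m<m+n t z<s ∷ subst (λ m → Below m (place (suc t) v)) (sym (ℕP.+-suc t N)) (place-below v)

place-ascending : (v : Vec B N) → Ascending (place t v)
place-ascending []      = []
place-ascending (b ∷ v) = place-above v ∷ place-ascending v

place-[] : (l : Line k N) (a : Fin k) → place t l [ a ] ≡ place t (l ⟨ a ⟩)
place-[] []      a = refl
place-[] (c ∷ l) a = cong (_ ∷_) (place-[] l a)

place-star : {l : Line k N} → IsLine l → Any (λ x → proj₂ x ≡ nothing) (place t l)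
place-star (here  c≡⋆) = here c≡⋆
place-star (there ⋆∈l) = there (place-star ⋆∈l)

embed : List (ℕ × Fin k) → List (ℕ × Maybe (Fin k))
embed = List.map (λ x → proj₁ x , just (proj₂ x))

embed-[] : (cs : List (ℕ × Fin k)) (a : Fin k) → embed cs [ a ] ≡ cs
embed-[] cs a = trans (sym (ListP.map-∘ cs)) (ListP.map-id cs)

flatten : (ℕ → List (ℕ × Maybe (Fin k))) → List (ℕ × Fin k) → List (ℕ × Fin k)
flatten S = concatMap (λ x → S (proj₁ x) [ proj₂ x ])

flatten-∷ʳ : (S : ℕ → List (ℕ × Maybe (Fin k))) (s : List (ℕ × Fin k)) (j : ℕ) (a : Fin k) →
             flatten S (s ∷ʳ (j , a)) ≡ flatten S s ++ S j [ a ]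
flatten-∷ʳ S s j a = trans (ListP.concatMap-++ _ s _) (cong (flatten S s ++_) (ListP.++-identityʳ _))

module BlockSequence (X : BlockSeq k) where

  private
    block : ℕ → VWord k
    block = proj₁ X

    block-isVarWord : ∀ j → IsVarWord (block j)
    block-isVarWord = proj₁ (proj₂ X)

  block-≺ : ∀ {j j′} → j < j′ → block j ≺ block j′
  block-≺ {j} {suc j′} (s≤s j≤j′) with ℕP.m≤n⇒m<n∨m≡n j≤j′
  ... | inj₁ j<j′ = ≺-trans (proj₁ (block-isVarWord j′)) (block-≺ j<j′) (proj₂ (proj₂ X) j′)
  ... | inj₂ refl = proj₂ (proj₂ X) j

  chosen : ℕ × Maybe (Fin k) → VWord k
  chosen x = block (proj₁ x) [ proj₂ x ]⋆

  chosen-ascending : ∀ x → Ascending (chosen x)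
  chosen-ascending (j , c) = []⋆-ascending c (incr⇒ascending (proj₁ (proj₂ (block-isVarWord j))))

  chosen-≺ : ∀ {x y} → x <ₚ y → chosen x ≺ chosen y
  chosen-≺ {j , c} {j′ , c′} j<j′ = []⋆-≺ c c′ (block-≺ j<j′)

  combA⋆-ascending : {s : List (ℕ × Maybe (Fin k))} → Ascending s → Ascending (combA⋆ X s)
  combA⋆-ascending {s} asc =
    AllPairsP.concat⁺ (AllP.map⁺ (All.universal chosen-ascending s))
                      (AllPairsP.map⁺ (AllPairs.map (λ {x} {y} → chosen-≺ {x} {y}) asc))

  combA⋆-≺ : {s s′ : List (ℕ × Maybe (Fin k))} → s ≺ s′ → combA⋆ X s ≺ combA⋆ X s′
  combA⋆-≺ = AllP.concat⁺ ∘ AllP.map⁺ ∘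
             All.map (λ {x} → ≺-concatʳ ∘ AllP.map⁺ ∘ All.map (λ {y} → chosen-≺ {x} {y}))

  combA⋆-star : {s : List (ℕ × Maybe (Fin k))} → Any (λ x → proj₂ x ≡ nothing) s →
                Any (λ x → proj₂ x ≡ nothing) (combA⋆ X s)
  combA⋆-star = AnyP.concat⁺ ∘ AnyP.map⁺ ∘ Any.map star-chosen
    where
    star-chosen : ∀ {x} → proj₂ x ≡ nothing → Any (λ y → proj₂ y ≡ nothing) (chosen x)
    star-chosen {j , .nothing} refl = proj₂ (proj₂ (block-isVarWord j))

  ∈[]A⋆⇒isVarWord : ∀ {p} → p ∈[ X ]A⋆ → IsVarWord p
  ∈[]A⋆⇒isVarWord (s , ((_ , incr) , star) , refl) =
    any⇒nonEmpty (combA⋆-star star) ,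
    AllPairs⇒Linked (combA⋆-ascending (incr⇒ascending incr)) ,
    combA⋆-star star

  combA⋆-[] : (s : List (ℕ × Maybe (Fin k))) (a : Fin k) → combA⋆ X s [ a ] ≡ combA X (s [ a ])
  combA⋆-[] s a = begin
    List.map _ (concatMap chosen s)                                 ≡⟨ ListP.map-concatMap _ _ s ⟩
    concatMap (λ x → chosen x [ a ]) s                              ≡⟨ ListP.concatMap-cong chosen-[] s ⟩
    concatMap (λ x → block (proj₁ x) [ fromMaybe a (proj₂ x) ]) s   ≡⟨ ListP.concatMap-map _ _ s ⟨
    combA X (s [ a ])                                               ∎
    where
    chosen-[] : ∀ x → chosen x [ a ] ≡ block (proj₁ x) [ fromMaybe a (proj₂ x) ]
    chosen-[] (j , c) = []⋆-[] (block j) c a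

  combA-++ : (s s′ : List (ℕ × Fin k)) → combA X (s ++ s′) ≡ combA X s ++ combA X s′
  combA-++ = ListP.concatMap-++ _

  module _ (S : ℕ → List (ℕ × Maybe (Fin k)))
           (valid : ∀ j → ValidChoice⋆ (S j)) (S-≺ : ∀ j → S j ≺ S (suc j)) where

    subBlockSeq : BlockSeq k
    subBlockSeq = combA⋆ X ∘ S , (λ j → ∈[]A⋆⇒isVarWord (S j , valid j , refl)) , combA⋆-≺ ∘ S-≺

    subBlockSeq-⊆ : subBlockSeq ⊆[ X ]A⋆
    subBlockSeq-⊆ j = S j , valid j , refl

    combA-subBlockSeq : (s : List (ℕ × Fin k)) → combA subBlockSeq s ≡ combA X (flatten S s)
    combA-subBlockSeq []            = refl
    combA-subBlockSeq ((j , a) ∷ s) = begin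
      combA⋆ X (S j) [ a ] ++ combA subBlockSeq s      ≡⟨ cong₂ _++_ (combA⋆-[] (S j) a) (combA-subBlockSeq s) ⟩
      combA X (S j [ a ]) ++ combA X (flatten S s)     ≡⟨ combA-++ (S j [ a ]) (flatten S s) ⟨
      combA X (flatten S ((j , a) ∷ s))                ∎

  combA⋆-prefix-line : (w : List (ℕ × Fin k)) (l : Line k N) (b : Fin k) →
                       combA⋆ X (embed w ++ place t l) [ b ] ≡ combA X (w ++ place t (l ⟨ b ⟩))
  combA⋆-prefix-line {t = t} w l b = begin
    combA⋆ X (embed w ++ place t l) [ b ]         ≡⟨ combA⋆-[] (embed w ++ place t l) b ⟩
    combA X ((embed w ++ place t l) [ b ])        ≡⟨ cong (combA X) (ListP.map-++ _ (embed w) (place t l)) ⟩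
    combA X (embed w [ b ] ++ place t l [ b ])    ≡⟨ cong (combA X) (cong₂ _++_ (embed-[] w b) (place-[] l b)) ⟩
    combA X (w ++ place t (l ⟨ b ⟩))              ∎

module Construction {C : Set} (_≟_ : DecidableEquality C) (X : BlockSeq k) (f : Word k → C) (i : C) where

  open BlockSequence X

  Prefixes : Set
  Prefixes = List (List (ℕ × Fin k))

  width : Prefixes → ℕ
  width W = lineNumber k (suc (length W))

  HitsAfter : ℕ → List (ℕ × Fin k) → Vec (Fin k) N → Set
  HitsAfter t cs u = f (combA X (cs ++ place t u)) ≡ i

  witnessLine : (t : ℕ) (W : Prefixes) → UniformWitnessLine W (HitsAfter t)
  witnessLine t W = uniformWitnessLine W (HitsAfter t) (λ cs u → f (combA X (cs ++ place t u)) ≟ i)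

  lineAfter : (t : ℕ) (W : Prefixes) → Line k (width W)
  lineAfter t W = UniformWitnessLine.line (witnessLine t W)

  -- start j is the first block of X not used by Y₀, …, Y_{j-1}, and prefixes j lists the words
  -- of [X]_A that those blocks generate, together with the empty word.
  stage : ℕ → ℕ × Prefixes
  stage zero    = 0 , [] ∷ []
  stage (suc j) = let (t , W) = stage j in
    t + width W , W ++ cartesianProductWith (λ cs a → cs ++ place t (lineAfter t W) [ a ]) W (allFin k)

  start : ℕ → ℕ
  start = proj₁ ∘ stage

  prefixes : ℕ → Prefixes
  prefixes = proj₂ ∘ stage

  line : (j : ℕ) → Line k (width (prefixes j))
  line j = lineAfter (start j) (prefixes j)

  choice : ℕ → List (ℕ × Maybe (Fin k))
  choice j = place (start j) (line j)

  choice-valid : ∀ j → ValidChoice⋆ (choice j)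
  choice-valid j = (any⇒nonEmpty star , AllPairs⇒Linked (place-ascending (line j))) , star
    where
    star : Any (λ x → proj₂ x ≡ nothing) (choice j)
    star = place-star (UniformWitnessLine.isLine (witnessLine (start j) (prefixes j)))

  choice-≺ : ∀ j → choice j ≺ choice (suc j)
  choice-≺ j = below-above⇒≺ (place-below (line j)) (place-above (line (suc j)))

  Y : BlockSeq k
  Y = subBlockSeq choice choice-valid choice-≺

  Y-⊆ : Y ⊆[ X ]A⋆
  Y-⊆ = subBlockSeq-⊆ choice choice-valid choice-≺

  prefixes-valid : ∀ j {cs} → cs ∈ prefixes j → Ascending cs × Below (start j) cs
  prefixes-valid zero    (here refl) = [] , []
  prefixes-valid (suc j) cs∈ with ∈-++⁻ (prefixes j) cs∈
  ... | inj₁ old = proj₁ (prefixes-valid j old) , below-mono (ℕP.m≤m+n _ _) (proj₂ (prefixes-valid j old))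
  ... | inj₂ new with ∈-cartesianProductWith⁻ _ (prefixes j) (allFin k) new
  ...   | cs , a , cs∈ , _ , refl with prefixes-valid j cs∈
  ...     | asc , below =
    ascending-++ asc below (AllPairsP.map⁺ (place-ascending (line j))) (AllP.map⁺ (place-above (line j))) ,
    AllP.++⁺ (below-mono (ℕP.m≤m+n _ _) below) (AllP.map⁺ (place-below (line j)))

  prefixes-complete : ∀ j (ys : List (ℕ × Fin k)) → Ascending ys → Below j ys → flatten choice ys ∈ prefixes j
  prefixes-complete zero    []      _   _        = here refl
  prefixes-complete zero    (_ ∷ _) _   (() ∷ _)
  prefixes-complete (suc j) ys asc below with initLast ys
  ... | []              = ∈-++⁺ˡ (prefixes-complete j [] [] [])
  ... | zs ∷ʳ′ (j′ , a)
    with ascending-∷ʳ⁻ asc | ℕP.m≤n⇒m<n∨m≡n (ℕP.≤-pred (All.head (AllP.++⁻ʳ zs below)))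
  ...   | _      , zs<j′ | inj₁ j′<j = ∈-++⁺ˡ (prefixes-complete j (zs ∷ʳ (j′ , a)) asc
                                        (AllP.∷ʳ⁺ (All.map (λ z<j′ → ℕP.<-trans z<j′ j′<j) zs<j′) j′<j))
  ...   | asc-zs , zs<j  | inj₂ refl = subst (_∈ prefixes (suc j)) (sym (flatten-∷ʳ choice zs j a))
    (∈-++⁺ʳ (prefixes j) (∈-cartesianProductWith⁺ _ (prefixes-complete j zs asc-zs zs<j) (∈-allFin a)))

  module _ (weaklyThin : WeaklyThin X f i) where

    ¬uniformHit : ∀ j {w} → w ∈ prefixes j → ¬ (∀ b → HitsAfter (start j) w (line j ⟨ b ⟩))
    ¬uniformHit j {w} w∈ always
      with weaklyThin (embed w ++ choice j) ((any⇒nonEmpty star , AllPairs⇒Linked asc) , star)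
      where
      star : Any (λ x → proj₂ x ≡ nothing) (embed w ++ choice j)
      star = AnyP.++⁺ʳ (embed w) (place-star (UniformWitnessLine.isLine (witnessLine (start j) (prefixes j))))
      asc : Ascending (embed w ++ choice j)
      asc = ascending-++ (AllPairsP.map⁺ (proj₁ (prefixes-valid j w∈))) (AllP.map⁺ (proj₂ (prefixes-valid j w∈)))
                         (place-ascending (line j)) (place-above (line j))
    ... | b , miss = miss (trans (cong f (combA⋆-prefix-line w (line j) b)) (always b))

    prefix-line-avoids : ∀ j {cs} → cs ∈ prefixes j → ∀ a → f (combA X (cs ++ choice j [ a ])) ≢ i
    prefix-line-avoids j {cs} cs∈ a hit
      with UniformWitnessLine.uniform (witnessLine (start j) (prefixes j)) a cs∈
             (subst (λ w → f (combA X (cs ++ w)) ≡ i) (place-[] (line j) a) hit)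
    ... | w , w∈ , always = ¬uniformHit j w∈ always

    Y-thin : Thin Y f i
    Y-thin s (nonEmpty , incr) hit with initLast s
    ... | []             = ⊥-elim (ℕP.<-irrefl refl nonEmpty)
    ... | ys ∷ʳ′ (j , a) with ascending-∷ʳ⁻ (incr⇒ascending incr)
    ...   | asc , below = prefix-line-avoids j (prefixes-complete j ys asc below) a (trans (cong f eq) hit)
      where
      eq : combA X (flatten choice ys ++ choice j [ a ]) ≡ combA Y (ys ∷ʳ (j , a))
      eq = sym (trans (combA-subBlockSeq choice choice-valid choice-≺ (ys ∷ʳ (j , a)))
                      (cong (combA X) (flatten-∷ʳ choice ys j a)))

lemma3p3 : (n m : ℕ) (X : BlockSeq (suc n)) (f : Word (suc n) → Fin (suc m)) (i : Fin (suc m))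
    → WeaklyThin X f i
    → Σ (BlockSeq (suc n)) (λ Y → (Y ⊆[ X ]A⋆) × Thin Y f i)
lemma3p3 n m X f i weaklyThin = Y , Y-⊆ , Y-thin weaklyThin
  where open Construction FinP._≟_ X f i
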